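{- For positive integers $n\ge k$, $|u(n,k)|$ equals the number of ordered pairs $(\sigma,\tau)$ of permutations of $[n]$, each having $k$ cycles, such that $\min(\sigma)=\min(\tau)$.
   Context: The central factorial numbers of the first kind of even indices $u(n,k)$ are defined by $\prod_{i=0}^{n-1}(x-i^2)=\sum_{k=0}^n u(n,k)x^k$ (equivalently $u(n,k)=t(2n,2k)$ in Riordan's notation, satisfying $u(n,k)=u(n-1,k-1)-(n-1)^2u(n-1,k)$). For a permutation $\sigma$ of $[n]=\{1,\dots,n\}$, $\min(\sigma)$ is the set of cyclic minima, i.e. $\{j\in[n]: j=\min\{\sigma^\ell(j):\ell\ge1\}\}$. -}

module Defs where

open import Data.Nat as ℕ using (ℕ; zero; suc; _≤_)
open import Data.Integer as ℤ using (ℤ; +_)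
open import Data.List using (List; []; _∷_; length)
open import Data.List.Membership.Propositional using (_∈_)
open import Data.List.Relation.Unary.Unique.Propositional using (Unique)
open import Data.Fin using (Fin; toℕ)
open import Data.Vec using (Vec; lookup)
open import Data.Product using (Σ; _×_)
open import Function.Bundles using (_⇔_)
open import Function.Definitions using (Bijective)
open import Relation.Binary.PropositionalEquality using (_≡_)

-- Polynomials over ℤ as coefficient lists, lowest degree first.

Poly : Set
Poly = List ℤ

addP : Poly → Poly → Poly
addP [] q = q
addP p [] = p
addP (a ∷ p) (b ∷ q) = (a ℤ.+ b) ∷ addP p q

scaleP : ℤ → Poly → Poly
scaleP c [] = []
scaleP c (a ∷ p) = (c ℤ.* a) ∷ scaleP c p

mulLin : ℤ → Poly → Poly
mulLin c p = addP (+ 0 ∷ p) (scaleP (ℤ.- c) p)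

coeff : Poly → ℕ → ℤ
coeff [] k = + 0
coeff (a ∷ p) zero = a
coeff (a ∷ p) (suc k) = coeff p k

prodPoly : ℕ → Poly
prodPoly zero = + 1 ∷ []
prodPoly (suc n) = mulLin (+ (n ℕ.* n)) (prodPoly n)

u : ℕ → ℕ → ℤ
u n k = coeff (prodPoly n) k

-- Permutations of [n] = Fin n, given by their value table.

IsPerm : ∀ {n} → Vec (Fin n) n → Set
IsPerm σ = Bijective _≡_ _≡_ (lookup σ)

iter : ∀ {n} → Vec (Fin n) n → ℕ → Fin n → Fin n
iter σ zero j = j
iter σ (suc ℓ) j = lookup σ (iter σ ℓ j)

-- j ∈ min(σ):  j = min { σ^ℓ(j) : ℓ ≥ 1 }.
IsCycMin : ∀ {n} → Vec (Fin n) n → Fin n → Set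
IsCycMin σ j = (Σ ℕ λ ℓ → iter σ (suc ℓ) j ≡ j)
             × (∀ ℓ → toℕ j ≤ toℕ (iter σ (suc ℓ) j))

-- "the number of a ∈ A with P a is m": a duplicate-free list enumerating
-- exactly the elements satisfying P has length m.
NumberOf : {A : Set} → (A → Set) → ℕ → Set
NumberOf {A} P m = Σ (List A) λ L → Unique L × (∀ a → (a ∈ L) ⇔ P a) × (length L ≡ m)

-- number of cycles of σ is k (each cycle contains exactly one cyclic minimum)
HasCycles : ∀ {n} → Vec (Fin n) n → ℕ → Set
HasCycles σ k = NumberOf (IsCycMin σ) k

SameMin : ∀ {n} → Vec (Fin n) n → Vec (Fin n) n → Set
SameMin {n} σ τ = ∀ (j : Fin n) → IsCycMin σ j ⇔ IsCycMin τ j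

GoodPair : ∀ n → ℕ → Vec (Fin n) n × Vec (Fin n) n → Set
GoodPair n k (σ Data.Product., τ) =
  IsPerm σ × IsPerm τ × HasCycles σ k × HasCycles τ k × SameMin σ τ

{-# OPTIONS --safe #-}
-- Up to the sign (-1)^(n+k), u satisfies u⁺(n+1,k+1) = u⁺(n,k) + n² u⁺(n,k+1), so it suffices to
-- show that the good pairs obey the same recurrence. A permutation of {0,…,n} arises in exactly one
-- way from a permutation σ of {0,…,n-1}: either n is added as a fixed point, which adds a cycle
-- whose minimum is n, or n is inserted into a cycle of σ right after some a, which keeps the
-- cycles and, n being the largest point, the cyclic minima. Two permutations with the same cyclic
-- minima must be extended the same way (n is a minimum of one iff of the other), and in the
-- second case a and b can be chosen freely: n² choices.
module Submission where

open import Defs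
open import Data.Nat as ℕ using (ℕ; zero; suc; _≤_)
import Data.Nat.Properties as ℕP
open import Data.Integer as ℤ using (ℤ; +_; -1ℤ; _^_; ∣_∣)
import Data.Integer.Properties as ℤP
open import Data.Integer.Solver using (module +-*-Solver)
open import Data.Fin using (Fin; zero; suc; fromℕ; inject₁; toℕ; _≟_)
open import Data.Fin.Properties using (¬Fin0; inject₁-injective; fromℕ≢inject₁; toℕ-inject₁; toℕ-fromℕ; toℕ<n; ≤fromℕ)
open import Data.Fin.Relation.Unary.Top using (view; ‵fromℕ; ‵inject₁; view-fromℕ)
open import Data.Vec as Vec using (Vec; []; _∷_; lookup; tabulate; _∷ʳ_; _[_]≔_)
open import Data.Vec.Properties using (lookup-map; lookup∘update; lookup∘update′; lookup∘tabulate; tabulate∘lookup; tabulate-cong)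
open import Data.List using (List; []; _∷_; length; map; _++_; allFin; cartesianProduct; cartesianProductWith)
open import Data.List.Properties using (length-map; length-++; length-tabulate)
open import Data.List.Membership.Propositional using (_∈_)
open import Data.List.Membership.Propositional.Properties
  using (∈-map⁺; ∈-map⁻; ∈-++⁺ˡ; ∈-++⁺ʳ; ∈-++⁻; ∈-allFin; ∈-cartesianProduct⁺; ∈-cartesianProductWith⁺; ∈-cartesianProductWith⁻)
open import Data.List.Membership.Propositional.Properties.WithK using (unique∧set⇒bag)
open import Data.List.Relation.Binary.BagAndSetEquality using (∼bag⇒↭)
open import Data.List.Relation.Binary.Permutation.Propositional.Properties using (↭-length)
import Data.List.Relation.Unary.All as All
open import Data.List.Relation.Unary.Any using (here; there)
open import Data.List.Relation.Unary.AllPairs using ([]; _∷_)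
open import Data.List.Relation.Unary.Unique.Propositional using (Unique)
open import Data.List.Relation.Binary.Disjoint.Propositional using (Disjoint)
import Data.List.Relation.Unary.Unique.Propositional.Properties as Unique
open import Data.Product using (∃; _×_; _,_; proj₁; proj₂)
open import Data.Sum using (_⊎_; inj₁; inj₂)
open import Data.Empty using (⊥; ⊥-elim)
open import Relation.Nullary using (¬_; yes; no)
open import Relation.Binary.PropositionalEquality
open import Function.Bundles using (_⇔_; mk⇔; Equivalence)
open Equivalence using (to; from)
import Function.Properties.Equivalence as ⇔
open import Function.Definitions using (Injective; StrictlySurjective)
open import Function.Consequences.Propositional using (surjective⇒strictlySurjective; strictlySurjective⇒surjective)

private
  variable
    A : Set
    n : ℕ

coeff-addP : ∀ p q k → coeff (addP p q) k ≡ coeff p k ℤ.+ coeff q k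
coeff-addP [] q k = sym (ℤP.+-identityˡ _)
coeff-addP (a ∷ p) [] k = sym (ℤP.+-identityʳ _)
coeff-addP (a ∷ p) (b ∷ q) zero = refl
coeff-addP (a ∷ p) (b ∷ q) (suc k) = coeff-addP p q k

coeff-scaleP : ∀ c p k → coeff (scaleP c p) k ≡ c ℤ.* coeff p k
coeff-scaleP c [] k = sym (ℤP.*-zeroʳ c)
coeff-scaleP c (a ∷ p) zero = refl
coeff-scaleP c (a ∷ p) (suc k) = coeff-scaleP c p k

coeff-mulLin : ∀ c p k → coeff (mulLin c p) k ≡ coeff (+ 0 ∷ p) k ℤ.- c ℤ.* coeff p k
coeff-mulLin c p k = begin
  coeff (mulLin c p) k                             ≡⟨ coeff-addP (+ 0 ∷ p) (scaleP (ℤ.- c) p) k ⟩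
  coeff (+ 0 ∷ p) k ℤ.+ coeff (scaleP (ℤ.- c) p) k ≡⟨ cong (λ z → coeff (+ 0 ∷ p) k ℤ.+ z) (coeff-scaleP (ℤ.- c) p k) ⟩
  coeff (+ 0 ∷ p) k ℤ.+ (ℤ.- c) ℤ.* coeff p k      ≡⟨ cong (λ z → coeff (+ 0 ∷ p) k ℤ.+ z) (sym (ℤP.neg-distribˡ-* c (coeff p k))) ⟩
  coeff (+ 0 ∷ p) k ℤ.- c ℤ.* coeff p k            ∎
  where open ≡-Reasoning

u⁺ : ℕ → ℕ → ℕ
u⁺ zero zero = 1
u⁺ zero (suc k) = 0
u⁺ (suc n) zero = n ℕ.* n ℕ.* u⁺ n zero
u⁺ (suc n) (suc k) = u⁺ n k ℕ.+ n ℕ.* n ℕ.* u⁺ n (suc k)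

u≡±u⁺ : ∀ n k → u n k ≡ -1ℤ ^ n ℤ.* -1ℤ ^ k ℤ.* + u⁺ n k
u≡±u⁺ zero zero = refl
u≡±u⁺ zero (suc k) = sym (ℤP.*-zeroʳ (-1ℤ ^ 0 ℤ.* -1ℤ ^ suc k))
u≡±u⁺ (suc n) zero = begin
  u (suc n) 0                                ≡⟨ coeff-mulLin N (prodPoly n) 0 ⟩
  + 0 ℤ.- N ℤ.* u n 0                        ≡⟨ cong (λ z → + 0 ℤ.- N ℤ.* z) (u≡±u⁺ n 0) ⟩
  + 0 ℤ.- N ℤ.* (εₙ ℤ.* + 1 ℤ.* x)           ≡⟨ solve 3 (λ N εₙ x → con (+ 0) :- N :* (εₙ :* con (+ 1) :* x)
                                                                 := (con -1ℤ :* εₙ) :* con (+ 1) :* (N :* x))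
                                                        refl N εₙ x ⟩
  (-1ℤ ℤ.* εₙ) ℤ.* + 1 ℤ.* (N ℤ.* x)         ≡⟨ cong ((-1ℤ ℤ.* εₙ) ℤ.* + 1 ℤ.*_) (sym (ℤP.pos-* (n ℕ.* n) (u⁺ n 0))) ⟩
  -1ℤ ^ suc n ℤ.* -1ℤ ^ 0 ℤ.* + u⁺ (suc n) 0 ∎
  where
    open ≡-Reasoning
    open +-*-Solver
    N εₙ x : ℤ
    N = + (n ℕ.* n)
    εₙ = -1ℤ ^ n
    x = + u⁺ n 0
u≡±u⁺ (suc n) (suc k) = begin
  u (suc n) (suc k)                                     ≡⟨ coeff-mulLin N (prodPoly n) (suc k) ⟩
  u n k ℤ.- N ℤ.* u n (suc k)                           ≡⟨ cong₂ (λ z w → z ℤ.- N ℤ.* w) (u≡±u⁺ n k) (u≡±u⁺ n (suc k)) ⟩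
  εₙ ℤ.* εₖ ℤ.* x ℤ.- N ℤ.* (εₙ ℤ.* (-1ℤ ℤ.* εₖ) ℤ.* y) ≡⟨ solve 5 (λ N εₙ εₖ x y → εₙ :* εₖ :* x :- N :* (εₙ :* (con -1ℤ :* εₖ) :* y)
                                                                            := (con -1ℤ :* εₙ) :* (con -1ℤ :* εₖ) :* (x :+ N :* y))
                                                                   refl N εₙ εₖ x y ⟩
  (-1ℤ ℤ.* εₙ) ℤ.* (-1ℤ ℤ.* εₖ) ℤ.* (x ℤ.+ N ℤ.* y)     ≡⟨ cong ((-1ℤ ℤ.* εₙ) ℤ.* (-1ℤ ℤ.* εₖ) ℤ.*_) unsigned ⟩
  -1ℤ ^ suc n ℤ.* -1ℤ ^ suc k ℤ.* + u⁺ (suc n) (suc k)  ∎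
  where
    open ≡-Reasoning
    open +-*-Solver
    N εₙ εₖ x y : ℤ
    N = + (n ℕ.* n)
    εₙ = -1ℤ ^ n
    εₖ = -1ℤ ^ k
    x = + u⁺ n k
    y = + u⁺ n (suc k)

    unsigned : x ℤ.+ N ℤ.* y ≡ + u⁺ (suc n) (suc k)
    unsigned = trans (cong (λ z → x ℤ.+ z) (sym (ℤP.pos-* (n ℕ.* n) (u⁺ n (suc k)))))
                     (sym (ℤP.pos-+ (u⁺ n k) (n ℕ.* n ℕ.* u⁺ n (suc k))))

∣-1ℤ^n∣≡1 : ∀ n → ∣ -1ℤ ^ n ∣ ≡ 1
∣-1ℤ^n∣≡1 zero = refl
∣-1ℤ^n∣≡1 (suc n) = trans (ℤP.∣i*j∣≡∣i∣*∣j∣ -1ℤ (-1ℤ ^ n)) (trans (ℕP.*-identityˡ _) (∣-1ℤ^n∣≡1 n))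

∣u∣≡u⁺ : ∀ n k → ∣ u n k ∣ ≡ u⁺ n k
∣u∣≡u⁺ n k = begin
  ∣ u n k ∣                              ≡⟨ cong ∣_∣ (u≡±u⁺ n k) ⟩
  ∣ -1ℤ ^ n ℤ.* -1ℤ ^ k ℤ.* + u⁺ n k ∣   ≡⟨ ℤP.∣i*j∣≡∣i∣*∣j∣ (-1ℤ ^ n ℤ.* -1ℤ ^ k) _ ⟩
  ∣ -1ℤ ^ n ℤ.* -1ℤ ^ k ∣ ℕ.* u⁺ n k     ≡⟨ cong (ℕ._* u⁺ n k) (ℤP.∣i*j∣≡∣i∣*∣j∣ (-1ℤ ^ n) (-1ℤ ^ k)) ⟩
  ∣ -1ℤ ^ n ∣ ℕ.* ∣ -1ℤ ^ k ∣ ℕ.* u⁺ n k ≡⟨ cong₂ (λ a b → a ℕ.* b ℕ.* u⁺ n k) (∣-1ℤ^n∣≡1 n) (∣-1ℤ^n∣≡1 k) ⟩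
  1 ℕ.* 1 ℕ.* u⁺ n k                     ≡⟨ ℕP.*-identityˡ (u⁺ n k) ⟩
  u⁺ n k                                 ∎
  where open ≡-Reasoning

lookup-∷ʳ-inject₁ : ∀ (xs : Vec A n) x i → lookup (xs ∷ʳ x) (inject₁ i) ≡ lookup xs i
lookup-∷ʳ-inject₁ (y ∷ xs) x zero = refl
lookup-∷ʳ-inject₁ (y ∷ xs) x (suc i) = lookup-∷ʳ-inject₁ xs x i

lookup-∷ʳ-fromℕ : ∀ (xs : Vec A n) x → lookup (xs ∷ʳ x) (fromℕ n) ≡ x
lookup-∷ʳ-fromℕ [] x = refl
lookup-∷ʳ-fromℕ (y ∷ xs) x = lookup-∷ʳ-fromℕ xs x

lookup-extensionality : ∀ (xs ys : Vec A n) → (∀ i → lookup xs i ≡ lookup ys i) → xs ≡ ys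
lookup-extensionality xs ys eq = trans (sym (tabulate∘lookup xs)) (trans (tabulate-cong eq) (tabulate∘lookup ys))

-- A left inverse of inject₁, with junk value d at n.
lowerOr : Fin n → Fin (suc n) → Fin n
lowerOr d x with view x
... | ‵fromℕ = d
... | ‵inject₁ j = j

lowerOr-fromℕ : ∀ (d : Fin n) → lowerOr d (fromℕ n) ≡ d
lowerOr-fromℕ {n} d rewrite view-fromℕ n = refl

inject₁-lowerOr : ∀ (d : Fin n) {x} → x ≢ fromℕ n → inject₁ (lowerOr d x) ≡ x
inject₁-lowerOr d {x} x≢n with view x
... | ‵fromℕ = ⊥-elim (x≢n refl)
... | ‵inject₁ j = refl

Table : ℕ → Set
Table n = Vec (Fin n) n

fixLast : Table n → Table (suc n)
fixLast {n} σ = Vec.map inject₁ σ ∷ʳ fromℕ n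

-- n enters the cycle of σ right after a: a ↦ n ↦ σ a.
insertAfter : Fin n → Table n → Table (suc n)
insertAfter {n} a σ = (Vec.map inject₁ σ [ a ]≔ fromℕ n) ∷ʳ inject₁ (lookup σ a)

module _ {n : ℕ} (σ : Table n) where

  lookup-fixLast-inject₁ : ∀ j → lookup (fixLast σ) (inject₁ j) ≡ inject₁ (lookup σ j)
  lookup-fixLast-inject₁ j = trans (lookup-∷ʳ-inject₁ (Vec.map inject₁ σ) _ j) (lookup-map j inject₁ σ)

  lookup-fixLast-fromℕ : lookup (fixLast σ) (fromℕ n) ≡ fromℕ n
  lookup-fixLast-fromℕ = lookup-∷ʳ-fromℕ (Vec.map inject₁ σ) _

  module _ (a : Fin n) where

    lookup-insertAfter-inject₁ : ∀ {j} → j ≢ a → lookup (insertAfter a σ) (inject₁ j) ≡ inject₁ (lookup σ j)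
    lookup-insertAfter-inject₁ {j} j≢a = begin
      lookup (insertAfter a σ) (inject₁ j)          ≡⟨ lookup-∷ʳ-inject₁ (Vec.map inject₁ σ [ a ]≔ fromℕ n) _ j ⟩
      lookup (Vec.map inject₁ σ [ a ]≔ fromℕ n) j   ≡⟨ lookup∘update′ j≢a (Vec.map inject₁ σ) (fromℕ n) ⟩
      lookup (Vec.map inject₁ σ) j                  ≡⟨ lookup-map j inject₁ σ ⟩
      inject₁ (lookup σ j)                          ∎
      where open ≡-Reasoning

    lookup-insertAfter-self : lookup (insertAfter a σ) (inject₁ a) ≡ fromℕ n
    lookup-insertAfter-self =
      trans (lookup-∷ʳ-inject₁ (Vec.map inject₁ σ [ a ]≔ fromℕ n) _ a) (lookup∘update a (Vec.map inject₁ σ) (fromℕ n))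

    lookup-insertAfter-fromℕ : lookup (insertAfter a σ) (fromℕ n) ≡ inject₁ (lookup σ a)
    lookup-insertAfter-fromℕ = lookup-∷ʳ-fromℕ (Vec.map inject₁ σ [ a ]≔ fromℕ n) _

iter-fixedPoint : ∀ (σ : Table n) {j} → lookup σ j ≡ j → ∀ ℓ → iter σ ℓ j ≡ j
iter-fixedPoint σ fixed zero = refl
iter-fixedPoint σ fixed (suc ℓ) = trans (cong (lookup σ) (iter-fixedPoint σ fixed ℓ)) fixed

isCycMin-fixedPoint : ∀ (σ : Table n) {j} → lookup σ j ≡ j → IsCycMin σ j
isCycMin-fixedPoint σ {j} fixed =
  (0 , fixed) , λ ℓ → subst (λ x → toℕ j ≤ toℕ x) (sym (iter-fixedPoint σ fixed (suc ℓ))) ℕP.≤-refl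

¬isCycMin-fromℕ : ∀ (τ : Table (suc n)) {y} → lookup τ (fromℕ n) ≡ inject₁ y → ¬ IsCycMin τ (fromℕ n)
¬isCycMin-fromℕ {n} τ {y} τn≡y (_ , minimal) =
  ℕP.<⇒≱ (toℕ<n y) (subst₂ _≤_ (toℕ-fromℕ n) (trans (cong toℕ τn≡y) (toℕ-inject₁ y)) (minimal 0))

record Follows {n} (τ : Table (suc n)) (σ : Table n) : Set where
  field
    arrow : ∀ y → lookup τ (inject₁ y) ≡ inject₁ (lookup σ y)
                ⊎ (lookup τ (inject₁ y) ≡ fromℕ n × lookup τ (fromℕ n) ≡ inject₁ (lookup σ y))

open Follows

follows-fixLast : ∀ (σ : Table n) → Follows (fixLast σ) σ
follows-fixLast σ .arrow y = inj₁ (lookup-fixLast-inject₁ σ y)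

follows-insertAfter : ∀ (σ : Table n) a → Follows (insertAfter a σ) σ
follows-insertAfter σ a .arrow y with y ≟ a
... | yes refl = inj₂ (lookup-insertAfter-self σ a , lookup-insertAfter-fromℕ σ a)
... | no y≢a = inj₁ (lookup-insertAfter-inject₁ σ a y≢a)

data OverOrbit {n} (τ : Table (suc n)) (σ : Table n) (j : Fin n) : Fin (suc n) → Set where
  lifted : ∀ m → OverOrbit τ σ j (inject₁ (iter σ (suc m) j))
  detour : ∀ m → lookup τ (fromℕ n) ≡ inject₁ (iter σ (suc m) j) → OverOrbit τ σ j (fromℕ n)

module _ {n} {τ : Table (suc n)} {σ : Table n} (follows : Follows τ σ) (j : Fin n) where

  private
    x : Fin (suc n)
    x = inject₁ j

  overOrbit-after : ∀ m → OverOrbit τ σ j (lookup τ (inject₁ (iter σ m j)))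
  overOrbit-after m with arrow follows (iter σ m j)
  ... | inj₁ step = subst (OverOrbit τ σ j) (sym step) (lifted m)
  ... | inj₂ (step , next) = subst (OverOrbit τ σ j) (sym step) (detour m next)

  overOrbit-iter : ∀ ℓ → OverOrbit τ σ j (iter τ (suc ℓ) x)
  overOrbit-iter zero = overOrbit-after 0
  overOrbit-iter (suc ℓ) = next (overOrbit-iter ℓ)
    where
      next : ∀ {y} → OverOrbit τ σ j y → OverOrbit τ σ j (lookup τ y)
      next (lifted m) = overOrbit-after (suc m)
      next (detour m τn≡) = subst (OverOrbit τ σ j) (sym τn≡) (lifted m)

  reach-next : ∀ {ℓ y} → iter τ ℓ x ≡ inject₁ y → ∃ λ ℓ′ → iter τ (suc ℓ′) x ≡ inject₁ (lookup σ y)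
  reach-next {ℓ} {y} τℓx≡y with arrow follows y
  ... | inj₁ step = ℓ , trans (cong (lookup τ) τℓx≡y) step
  ... | inj₂ (step , next) = suc ℓ , trans (cong (lookup τ) (trans (cong (lookup τ) τℓx≡y) step)) next

  reach-orbit : ∀ m → ∃ λ ℓ → iter τ (suc ℓ) x ≡ inject₁ (iter σ (suc m) j)
  reach-orbit zero = reach-next {0} refl
  reach-orbit (suc m) = let (ℓ , τℓx≡) = reach-orbit m in reach-next {suc ℓ} τℓx≡

  isCycMin-inject₁ : IsCycMin τ x ⇔ IsCycMin σ j
  isCycMin-inject₁ = mk⇔ down up
    where
      periodic : ∀ {y} → OverOrbit τ σ j y → y ≡ x → ∃ λ m → iter σ (suc m) j ≡ j
      periodic (lifted m) eq = m , inject₁-injective eq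
      periodic (detour m _) eq = ⊥-elim (fromℕ≢inject₁ eq)

      down : IsCycMin τ x → IsCycMin σ j
      down ((p , τpx≡x) , minimal) =
        periodic (overOrbit-iter p) τpx≡x ,
        λ m → let (ℓ , τℓx≡) = reach-orbit m in
              subst₂ _≤_ (toℕ-inject₁ j) (trans (cong toℕ τℓx≡) (toℕ-inject₁ _)) (minimal ℓ)

      bounded : IsCycMin σ j → ∀ {y} → OverOrbit τ σ j y → toℕ x ≤ toℕ y
      bounded (_ , minimal) (lifted m) = subst₂ _≤_ (sym (toℕ-inject₁ j)) (sym (toℕ-inject₁ _)) (minimal m)
      bounded _ (detour _ _) = ≤fromℕ x

      up : IsCycMin σ j → IsCycMin τ x
      up min@((p , σpj≡j) , _) =
        (let (ℓ , τℓx≡) = reach-orbit p in ℓ , trans τℓx≡ (cong inject₁ σpj≡j)) ,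
        λ ℓ → bounded min (overOrbit-iter ℓ)

mkIsPerm : ∀ (σ : Table n) → Injective _≡_ _≡_ (lookup σ) → StrictlySurjective _≡_ (lookup σ) → IsPerm σ
mkIsPerm σ inj surj = inj , strictlySurjective⇒surjective surj

preimage : ∀ (σ : Table n) → IsPerm σ → StrictlySurjective _≡_ (lookup σ)
preimage σ (_ , surj) = surjective⇒strictlySurjective surj

follows⇒isPerm : ∀ {τ : Table (suc n)} {σ : Table n} → Follows τ σ → IsPerm τ → IsPerm σ
follows⇒isPerm {n} {τ} {σ} follows τ-perm@(τ-inj , _) = mkIsPerm σ inj surj
  where
    detour-unique : ∀ {y z} → lookup τ (inject₁ y) ≡ inject₁ (lookup σ y) →
                    lookup τ (fromℕ n) ≡ inject₁ (lookup σ z) → lookup σ y ≡ lookup σ z → ⊥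
    detour-unique step next σy≡σz =
      fromℕ≢inject₁ (τ-inj (trans next (trans (cong inject₁ (sym σy≡σz)) (sym step))))

    inj : Injective _≡_ _≡_ (lookup σ)
    inj {y} {z} σy≡σz with arrow follows y | arrow follows z
    ... | inj₁ stepy | inj₁ stepz =
      inject₁-injective (τ-inj (trans stepy (trans (cong inject₁ σy≡σz) (sym stepz))))
    ... | inj₁ stepy | inj₂ (_ , next) = ⊥-elim (detour-unique stepy next σy≡σz)
    ... | inj₂ (_ , next) | inj₁ stepz = ⊥-elim (detour-unique stepz next (sym σy≡σz))
    ... | inj₂ (stepy , _) | inj₂ (stepz , _) = inject₁-injective (τ-inj (trans stepy (sym stepz)))

    hit-directly : ∀ {y c} → lookup τ (inject₁ y) ≡ inject₁ c → lookup σ y ≡ c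
    hit-directly {y} τy≡c with arrow follows y
    ... | inj₁ step = inject₁-injective (trans (sym step) τy≡c)
    ... | inj₂ (step , _) = ⊥-elim (fromℕ≢inject₁ (trans (sym step) τy≡c))

    hit-via-top : ∀ {c} → lookup τ (fromℕ n) ≡ inject₁ c → ∃ λ y → lookup σ y ≡ c
    hit-via-top τn≡c with preimage τ τ-perm (fromℕ n)
    ... | x , τx≡n with view x
    ...   | ‵fromℕ = ⊥-elim (fromℕ≢inject₁ (trans (sym τx≡n) τn≡c))
    ...   | ‵inject₁ y with arrow follows y
    ...     | inj₁ step = ⊥-elim (fromℕ≢inject₁ (trans (sym τx≡n) step))
    ...     | inj₂ (_ , next) = y , inject₁-injective (trans (sym next) τn≡c)

    surj : StrictlySurjective _≡_ (lookup σ)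
    surj c with preimage τ τ-perm (inject₁ c)
    ... | x , τx≡c with view x
    ...   | ‵fromℕ = hit-via-top τx≡c
    ...   | ‵inject₁ y = y , hit-directly τx≡c

isPerm-fixLast : ∀ (σ : Table n) → IsPerm σ → IsPerm (fixLast σ)
isPerm-fixLast {n} σ σ-perm@(σ-inj , _) = mkIsPerm (fixLast σ) inj surj
  where
    τ : Fin (suc n) → Fin (suc n)
    τ = lookup (fixLast σ)

    top-apart : ∀ j → τ (fromℕ n) ≢ τ (inject₁ j)
    top-apart j eq = fromℕ≢inject₁ (trans (sym (lookup-fixLast-fromℕ σ)) (trans eq (lookup-fixLast-inject₁ σ j)))

    inj : Injective _≡_ _≡_ τ
    inj {x} {y} eq with view x | view y
    ... | ‵fromℕ | ‵fromℕ = refl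
    ... | ‵fromℕ | ‵inject₁ j = ⊥-elim (top-apart j eq)
    ... | ‵inject₁ i | ‵fromℕ = ⊥-elim (top-apart i (sym eq))
    ... | ‵inject₁ i | ‵inject₁ j = cong inject₁ (σ-inj (inject₁-injective
      (trans (sym (lookup-fixLast-inject₁ σ i)) (trans eq (lookup-fixLast-inject₁ σ j)))))

    surj : StrictlySurjective _≡_ τ
    surj y with view y
    ... | ‵fromℕ = fromℕ n , lookup-fixLast-fromℕ σ
    ... | ‵inject₁ c = let (j , σj≡c) = preimage σ σ-perm c in
                       inject₁ j , trans (lookup-fixLast-inject₁ σ j) (cong inject₁ σj≡c)

isPerm-insertAfter : ∀ (σ : Table n) a → IsPerm σ → IsPerm (insertAfter a σ)
isPerm-insertAfter {n} σ a σ-perm@(σ-inj , _) = mkIsPerm (insertAfter a σ) inj surj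
  where
    τ : Fin (suc n) → Fin (suc n)
    τ = lookup (insertAfter a σ)

    top-apart : ∀ j → τ (fromℕ n) ≢ τ (inject₁ j)
    top-apart j eq with j ≟ a
    ... | yes refl = fromℕ≢inject₁ (trans (sym (lookup-insertAfter-self σ a))
                                          (trans (sym eq) (lookup-insertAfter-fromℕ σ a)))
    ... | no j≢a = j≢a (sym (σ-inj (inject₁-injective
                    (trans (sym (lookup-insertAfter-fromℕ σ a)) (trans eq (lookup-insertAfter-inject₁ σ a j≢a))))))

    old-inj : ∀ {i j} → τ (inject₁ i) ≡ τ (inject₁ j) → i ≡ j
    old-inj {i} {j} eq with i ≟ a | j ≟ a
    ... | yes i≡a | yes j≡a = trans i≡a (sym j≡a)
    ... | yes refl | no j≢a = ⊥-elim (fromℕ≢inject₁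
                                (trans (sym (lookup-insertAfter-self σ a)) (trans eq (lookup-insertAfter-inject₁ σ a j≢a))))
    ... | no i≢a | yes refl = ⊥-elim (fromℕ≢inject₁
                                (trans (sym (lookup-insertAfter-self σ a)) (trans (sym eq) (lookup-insertAfter-inject₁ σ a i≢a))))
    ... | no i≢a | no j≢a = σ-inj (inject₁-injective
      (trans (sym (lookup-insertAfter-inject₁ σ a i≢a)) (trans eq (lookup-insertAfter-inject₁ σ a j≢a))))

    inj : Injective _≡_ _≡_ τ
    inj {x} {y} eq with view x | view y
    ... | ‵fromℕ | ‵fromℕ = refl
    ... | ‵fromℕ | ‵inject₁ j = ⊥-elim (top-apart j eq)
    ... | ‵inject₁ i | ‵fromℕ = ⊥-elim (top-apart i (sym eq))
    ... | ‵inject₁ i | ‵inject₁ j = cong inject₁ (old-inj eq)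

    surj : StrictlySurjective _≡_ τ
    surj y with view y
    ... | ‵fromℕ = inject₁ a , lookup-insertAfter-self σ a
    ... | ‵inject₁ c with preimage σ σ-perm c
    ...   | j , σj≡c with j ≟ a
    ...     | yes refl = fromℕ n , trans (lookup-insertAfter-fromℕ σ a) (cong inject₁ σj≡c)
    ...     | no j≢a = inject₁ j , trans (lookup-insertAfter-inject₁ σ a j≢a) (cong inject₁ σj≡c)

-- Removes n from the cycles of τ, provided d supplies the lowered τ n wherever τ j = n.
cutTop : (Fin n → Fin n) → Table (suc n) → Table n
cutTop d τ = tabulate λ j → lowerOr (d j) (lookup τ (inject₁ j))

inject₁-lookup-cutTop : ∀ d (τ : Table (suc n)) j → lookup τ (inject₁ j) ≢ fromℕ n →
                        inject₁ (lookup (cutTop d τ) j) ≡ lookup τ (inject₁ j)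
inject₁-lookup-cutTop d τ j τj≢n = trans (cong inject₁ (lookup∘tabulate _ j)) (inject₁-lowerOr (d j) τj≢n)

fixLast-cutTop : ∀ (τ : Table (suc n)) → IsPerm τ → lookup τ (fromℕ n) ≡ fromℕ n → τ ≡ fixLast (cutTop (λ j → j) τ)
fixLast-cutTop {n} τ (τ-inj , _) τn≡n = lookup-extensionality τ (fixLast σ) point
  where
    σ : Table n
    σ = cutTop (λ j → j) τ

    point : ∀ x → lookup τ x ≡ lookup (fixLast σ) x
    point x with view x
    ... | ‵fromℕ = trans τn≡n (sym (lookup-fixLast-fromℕ σ))
    ... | ‵inject₁ j = trans (sym (inject₁-lookup-cutTop _ τ j λ τj≡n → fromℕ≢inject₁ (τ-inj (trans τn≡n (sym τj≡n)))))
                             (sym (lookup-fixLast-inject₁ σ j))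

insertAfter-cutTop : ∀ (τ : Table (suc n)) {a b} → IsPerm τ → lookup τ (inject₁ a) ≡ fromℕ n →
                     lookup τ (fromℕ n) ≡ inject₁ b → τ ≡ insertAfter a (cutTop (λ _ → b) τ)
insertAfter-cutTop {n} τ {a} {b} (τ-inj , _) τa≡n τn≡b = lookup-extensionality τ (insertAfter a σ) point
  where
    σ : Table n
    σ = cutTop (λ _ → b) τ

    σa≡b : lookup σ a ≡ b
    σa≡b = trans (lookup∘tabulate _ a) (trans (cong (lowerOr b) τa≡n) (lowerOr-fromℕ b))

    point : ∀ x → lookup τ x ≡ lookup (insertAfter a σ) x
    point x with view x
    ... | ‵fromℕ = trans τn≡b (trans (cong inject₁ (sym σa≡b)) (sym (lookup-insertAfter-fromℕ σ a)))
    ... | ‵inject₁ j with j ≟ a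
    ...   | yes refl = trans τa≡n (sym (lookup-insertAfter-self σ a))
    ...   | no j≢a = trans (sym (inject₁-lookup-cutTop _ τ j λ τj≡n → j≢a (inject₁-injective (τ-inj (trans τj≡n (sym τa≡n))))))
                           (sym (lookup-insertAfter-inject₁ σ a j≢a))

data Extension {n} : Table (suc n) → Set where
  fixed    : ∀ σ → IsPerm σ → Extension (fixLast σ)
  inserted : ∀ a σ → IsPerm σ → Extension (insertAfter a σ)

extension : ∀ (τ : Table (suc n)) → IsPerm τ → Extension τ
extension {n} τ τ-perm with lookup τ (fromℕ n) in τn≡ | view (lookup τ (fromℕ n))
... | _ | ‵fromℕ = fixed-extension (fixLast-cutTop τ τ-perm τn≡)
  where
    fixed-extension : ∀ {σ} → τ ≡ fixLast σ → Extension τ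
    fixed-extension {σ} refl = fixed σ (follows⇒isPerm (follows-fixLast σ) τ-perm)
... | _ | ‵inject₁ b with preimage τ τ-perm (fromℕ n)
...   | x , τx≡n with view x
...     | ‵fromℕ = ⊥-elim (fromℕ≢inject₁ (trans (sym τx≡n) τn≡))
...     | ‵inject₁ a = inserted-extension (insertAfter-cutTop τ τ-perm τx≡n τn≡)
  where
    inserted-extension : ∀ {σ} → τ ≡ insertAfter a σ → Extension τ
    inserted-extension {σ} refl = inserted a σ (follows⇒isPerm (follows-insertAfter σ a) τ-perm)

numberOf-unique : ∀ {P : A → Set} {m m′} → NumberOf P m → NumberOf P m′ → m ≡ m′
numberOf-unique (xs , xs-unique , xs-enum , refl) (ys , ys-unique , ys-enum , refl) =
  ↭-length (∼bag⇒↭ (unique∧set⇒bag xs-unique ys-unique λ {a} → ⇔.trans (xs-enum a) (⇔.sym (ys-enum a))))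

numberOf-Fin0 : ∀ (P : Fin 0 → Set) → NumberOf P 0
numberOf-Fin0 P = [] , [] , (λ ()) , refl

module _ {n} {P : Fin (suc n) → Set} {Q : Fin n → Set} (P⇔Q : ∀ j → P (inject₁ j) ⇔ Q j) where

  private
    inject₁-enumerates : ∀ {xs} → (∀ j → j ∈ xs ⇔ Q j) → ∀ j → inject₁ j ∈ map inject₁ xs ⇔ P (inject₁ j)
    inject₁-enumerates enum j = mk⇔
      (λ ιj∈ → let (y , y∈ , ιj≡ιy) = ∈-map⁻ inject₁ ιj∈ in
               from (P⇔Q j) (subst Q (sym (inject₁-injective ιj≡ιy)) (to (enum y) y∈)))
      (λ Pj → ∈-map⁺ inject₁ (from (enum j) (to (P⇔Q j) Pj)))

    fromℕ∉ : ∀ xs → ¬ fromℕ n ∈ map inject₁ xs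
    fromℕ∉ xs n∈ = let (_ , _ , n≡ιy) = ∈-map⁻ inject₁ n∈ in fromℕ≢inject₁ n≡ιy

  numberOf-inject₁ : ∀ {m} → ¬ P (fromℕ n) → NumberOf Q m → NumberOf P m
  numberOf-inject₁ ¬Pn (xs , unique , enum , refl) =
    map inject₁ xs , Unique.map⁺ inject₁-injective unique , enum′ , length-map inject₁ xs
    where
      enum′ : ∀ x → x ∈ map inject₁ xs ⇔ P x
      enum′ x with view x
      ... | ‵fromℕ = mk⇔ (λ n∈ → ⊥-elim (fromℕ∉ xs n∈)) (λ Pn → ⊥-elim (¬Pn Pn))
      ... | ‵inject₁ j = inject₁-enumerates enum j

  numberOf-fromℕ∷inject₁ : ∀ {m} → P (fromℕ n) → NumberOf Q m → NumberOf P (suc m)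
  numberOf-fromℕ∷inject₁ Pn (xs , unique , enum , refl) =
    fromℕ n ∷ map inject₁ xs ,
    All.tabulate (λ y∈ n≡y → fromℕ∉ xs (subst (_∈ map inject₁ xs) (sym n≡y) y∈)) ∷ Unique.map⁺ inject₁-injective unique ,
    enum′ , cong suc (length-map inject₁ xs)
    where
      enum′ : ∀ x → x ∈ fromℕ n ∷ map inject₁ xs ⇔ P x
      enum′ x with view x
      ... | ‵fromℕ = mk⇔ (λ _ → Pn) (λ _ → here refl)
      ... | ‵inject₁ j = mk⇔ (λ { (here ιj≡n) → ⊥-elim (fromℕ≢inject₁ (sym ιj≡n))
                                ; (there ιj∈) → to (inject₁-enumerates enum j) ιj∈ })
                             (λ Pj → there (from (inject₁-enumerates enum j) Pj))

isCycMin-fixLast-fromℕ : ∀ (σ : Table n) → IsCycMin (fixLast σ) (fromℕ n)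
isCycMin-fixLast-fromℕ σ = isCycMin-fixedPoint (fixLast σ) (lookup-fixLast-fromℕ σ)

¬isCycMin-insertAfter-fromℕ : ∀ (σ : Table n) a → ¬ IsCycMin (insertAfter a σ) (fromℕ n)
¬isCycMin-insertAfter-fromℕ σ a = ¬isCycMin-fromℕ (insertAfter a σ) (lookup-insertAfter-fromℕ σ a)

hasCycles-fixLast : ∀ (σ : Table n) {m} → HasCycles σ m → HasCycles (fixLast σ) (suc m)
hasCycles-fixLast σ =
  numberOf-fromℕ∷inject₁ (isCycMin-inject₁ (follows-fixLast σ)) (isCycMin-fixLast-fromℕ σ)

hasCycles-insertAfter : ∀ (σ : Table n) a {m} → HasCycles σ m → HasCycles (insertAfter a σ) m
hasCycles-insertAfter σ a =
  numberOf-inject₁ (isCycMin-inject₁ (follows-insertAfter σ a)) (¬isCycMin-insertAfter-fromℕ σ a)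

hasCycles-exists : ∀ (σ : Table n) → IsPerm σ → ∃ (HasCycles σ)
hasCycles-exists {zero} σ _ = 0 , numberOf-Fin0 _
hasCycles-exists {suc n} τ τ-perm with extension τ τ-perm
... | fixed σ σ-perm = let (m , cycles) = hasCycles-exists σ σ-perm in suc m , hasCycles-fixLast σ cycles
... | inserted a σ σ-perm = let (m , cycles) = hasCycles-exists σ σ-perm in m , hasCycles-insertAfter σ a cycles

hasCycles-fixLast⁻ : ∀ (σ : Table n) {k} → IsPerm σ → HasCycles (fixLast σ) k → ∃ λ m → k ≡ suc m × HasCycles σ m
hasCycles-fixLast⁻ σ σ-perm cycles =
  let (m , σ-cycles) = hasCycles-exists σ σ-perm in m , numberOf-unique cycles (hasCycles-fixLast σ σ-cycles) , σ-cycles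

hasCycles-insertAfter⁻ : ∀ (σ : Table n) a {k} → IsPerm σ → HasCycles (insertAfter a σ) k → HasCycles σ k
hasCycles-insertAfter⁻ σ a σ-perm cycles =
  let (m , σ-cycles) = hasCycles-exists σ σ-perm in
  subst (HasCycles σ) (numberOf-unique (hasCycles-insertAfter σ a σ-cycles) cycles) σ-cycles

module _ {n} {σ′ τ′ : Table (suc n)} {σ τ : Table n} (σ′-follows : Follows σ′ σ) (τ′-follows : Follows τ′ τ) where

  sameMin⁺ : (IsCycMin σ′ (fromℕ n) ⇔ IsCycMin τ′ (fromℕ n)) → SameMin σ τ → SameMin σ′ τ′
  sameMin⁺ same-top same x with view x
  ... | ‵fromℕ = same-top
  ... | ‵inject₁ j =
    ⇔.trans (isCycMin-inject₁ σ′-follows j) (⇔.trans (same j) (⇔.sym (isCycMin-inject₁ τ′-follows j)))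

  sameMin⁻ : SameMin σ′ τ′ → SameMin σ τ
  sameMin⁻ same j =
    ⇔.trans (⇔.sym (isCycMin-inject₁ σ′-follows j)) (⇔.trans (same (inject₁ j)) (isCycMin-inject₁ τ′-follows j))

TablePair : ℕ → Set
TablePair n = Table n × Table n

fixLast² : TablePair n → TablePair (suc n)
fixLast² (σ , τ) = fixLast σ , fixLast τ

insertAfter² : Fin n × Fin n → TablePair n → TablePair (suc n)
insertAfter² (a , b) (σ , τ) = insertAfter a σ , insertAfter b τ

goodPair-fixLast² : ∀ {k} (p : TablePair n) → GoodPair n k p → GoodPair (suc n) (suc k) (fixLast² p)
goodPair-fixLast² (σ , τ) (σ-perm , τ-perm , σ-cycles , τ-cycles , same) =
  isPerm-fixLast σ σ-perm , isPerm-fixLast τ τ-perm ,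
  hasCycles-fixLast σ σ-cycles , hasCycles-fixLast τ τ-cycles ,
  sameMin⁺ (follows-fixLast σ) (follows-fixLast τ)
           (mk⇔ (λ _ → isCycMin-fixLast-fromℕ τ) (λ _ → isCycMin-fixLast-fromℕ σ)) same

goodPair-insertAfter² : ∀ {k} ab (p : TablePair n) → GoodPair n k p → GoodPair (suc n) k (insertAfter² ab p)
goodPair-insertAfter² (a , b) (σ , τ) (σ-perm , τ-perm , σ-cycles , τ-cycles , same) =
  isPerm-insertAfter σ a σ-perm , isPerm-insertAfter τ b τ-perm ,
  hasCycles-insertAfter σ a σ-cycles , hasCycles-insertAfter τ b τ-cycles ,
  sameMin⁺ (follows-insertAfter σ a) (follows-insertAfter τ b)
           (mk⇔ (λ top → ⊥-elim (¬isCycMin-insertAfter-fromℕ σ a top)) (λ top → ⊥-elim (¬isCycMin-insertAfter-fromℕ τ b top))) same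

fixLast-injective : ∀ {σ τ : Table n} → fixLast σ ≡ fixLast τ → σ ≡ τ
fixLast-injective {σ = σ} {τ} eq = lookup-extensionality σ τ λ j → inject₁-injective
  (trans (sym (lookup-fixLast-inject₁ σ j)) (trans (cong (λ v → lookup v (inject₁ j)) eq) (lookup-fixLast-inject₁ τ j)))

insertAfter-injective : ∀ {a b} {σ τ : Table n} → insertAfter a σ ≡ insertAfter b τ → a ≡ b × σ ≡ τ
insertAfter-injective {a = a} {b} {σ} {τ} eq with a ≟ b
... | no a≢b = ⊥-elim (fromℕ≢inject₁
      (trans (sym (lookup-insertAfter-self σ a)) (trans (cong (λ v → lookup v (inject₁ a)) eq) (lookup-insertAfter-inject₁ τ b a≢b))))
... | yes refl = refl , lookup-extensionality σ τ point
  where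
    point : ∀ j → lookup σ j ≡ lookup τ j
    point j with j ≟ a
    ... | yes refl = inject₁-injective
      (trans (sym (lookup-insertAfter-fromℕ σ a)) (trans (cong (λ v → lookup v (fromℕ _)) eq) (lookup-insertAfter-fromℕ τ a)))
    ... | no j≢a = inject₁-injective
      (trans (sym (lookup-insertAfter-inject₁ σ a j≢a)) (trans (cong (λ v → lookup v (inject₁ j)) eq) (lookup-insertAfter-inject₁ τ a j≢a)))

fixLast≢insertAfter : ∀ (σ τ : Table n) a → fixLast σ ≢ insertAfter a τ
fixLast≢insertAfter σ τ a eq = fromℕ≢inject₁
  (trans (sym (lookup-fixLast-fromℕ σ)) (trans (cong (λ v → lookup v (fromℕ _)) eq) (lookup-insertAfter-fromℕ τ a)))

allFin² : (n : ℕ) → List (Fin n × Fin n)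
allFin² n = cartesianProduct (allFin n) (allFin n)

insertions : List (TablePair n) → List (TablePair (suc n))
insertions {n} = cartesianProductWith insertAfter² (allFin² n)

goodPairs : (n k : ℕ) → List (TablePair n)
goodPairs zero zero = ([] , []) ∷ []
goodPairs zero (suc k) = []
goodPairs (suc n) zero = insertions (goodPairs n zero)
goodPairs (suc n) (suc k) = map fixLast² (goodPairs n k) ++ insertions (goodPairs n (suc k))

length-cartesianProductWith : ∀ {B C : Set} (f : A → B → C) xs ys →
                              length (cartesianProductWith f xs ys) ≡ length xs ℕ.* length ys
length-cartesianProductWith f [] ys = refl
length-cartesianProductWith f (x ∷ xs) ys =
  trans (length-++ (map (f x) ys)) (cong₂ ℕ._+_ (length-map (f x) ys) (length-cartesianProductWith f xs ys))

length-insertions : ∀ (ps : List (TablePair n)) → length (insertions ps) ≡ n ℕ.* n ℕ.* length ps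
length-insertions {n} ps = begin
  length (insertions ps)                                ≡⟨ length-cartesianProductWith insertAfter² (allFin² n) ps ⟩
  length (allFin² n) ℕ.* length ps                      ≡⟨ cong (ℕ._* length ps) (length-cartesianProductWith _,_ (allFin n) (allFin n)) ⟩
  length (allFin n) ℕ.* length (allFin n) ℕ.* length ps ≡⟨ cong (λ m → m ℕ.* m ℕ.* length ps) (length-tabulate {n = n} (λ i → i)) ⟩
  n ℕ.* n ℕ.* length ps                                 ∎
  where open ≡-Reasoning

length-goodPairs : ∀ n k → length (goodPairs n k) ≡ u⁺ n k
length-goodPairs zero zero = refl
length-goodPairs zero (suc k) = refl
length-goodPairs (suc n) zero = trans (length-insertions (goodPairs n 0)) (cong (n ℕ.* n ℕ.*_) (length-goodPairs n 0))
length-goodPairs (suc n) (suc k) = begin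
  length (map fixLast² ps₀ ++ insertions ps₁)            ≡⟨ length-++ (map fixLast² ps₀) ⟩
  length (map fixLast² ps₀) ℕ.+ length (insertions ps₁)  ≡⟨ cong₂ ℕ._+_ (length-map fixLast² ps₀) (length-insertions ps₁) ⟩
  length ps₀ ℕ.+ n ℕ.* n ℕ.* length ps₁                  ≡⟨ cong₂ (λ x y → x ℕ.+ n ℕ.* n ℕ.* y) (length-goodPairs n k) (length-goodPairs n (suc k)) ⟩
  u⁺ (suc n) (suc k)                                            ∎
  where
    open ≡-Reasoning
    ps₀ ps₁ : List (TablePair n)
    ps₀ = goodPairs n k
    ps₁ = goodPairs n (suc k)

insertions-unique : ∀ {ps : List (TablePair n)} → Unique ps → Unique (insertions ps)
insertions-unique {n} = Unique.cartesianProductWith⁺ insertAfter² injective (Unique.cartesianProduct⁺ (Unique.allFin⁺ n) (Unique.allFin⁺ n))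
  where
    injective : ∀ {ab ab′ p p′} → insertAfter² ab p ≡ insertAfter² ab′ p′ → ab ≡ ab′ × p ≡ p′
    injective {a , b} {a′ , b′} {σ , τ} {σ′ , τ′} eq =
      let (a≡a′ , σ≡σ′) = insertAfter-injective (cong proj₁ eq) ; (b≡b′ , τ≡τ′) = insertAfter-injective (cong proj₂ eq) in
      cong₂ _,_ a≡a′ b≡b′ , cong₂ _,_ σ≡σ′ τ≡τ′

goodPairs-unique : ∀ n k → Unique (goodPairs n k)
goodPairs-unique zero zero = All.[] ∷ []
goodPairs-unique zero (suc k) = []
goodPairs-unique (suc n) zero = insertions-unique (goodPairs-unique n 0)
goodPairs-unique (suc n) (suc k) =
  Unique.++⁺ (Unique.map⁺ fixLast²-injective (goodPairs-unique n k)) (insertions-unique (goodPairs-unique n (suc k))) disjoint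
  where
    fixLast²-injective : ∀ {p q : TablePair n} → fixLast² p ≡ fixLast² q → p ≡ q
    fixLast²-injective eq = cong₂ _,_ (fixLast-injective (cong proj₁ eq)) (fixLast-injective (cong proj₂ eq))

    disjoint : Disjoint (map fixLast² (goodPairs n k)) (insertions (goodPairs n (suc k)))
    disjoint (p∈fixed , p∈inserted) =
      let ((σ , _) , _ , p≡fixed) = ∈-map⁻ fixLast² p∈fixed
          ((a , _) , (σ′ , _) , _ , _ , p≡inserted) = ∈-cartesianProductWith⁻ insertAfter² (allFin² n) (goodPairs n (suc k)) p∈inserted
      in fixLast≢insertAfter σ σ′ a (cong proj₁ (trans (sym p≡fixed) p≡inserted))

∈-insertions⁺ : ∀ ab {p} {ps : List (TablePair n)} → p ∈ ps → insertAfter² ab p ∈ insertions ps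
∈-insertions⁺ (a , b) = ∈-cartesianProductWith⁺ insertAfter² (∈-cartesianProduct⁺ (∈-allFin a) (∈-allFin b))

insertions-good : ∀ {k} {ps : List (TablePair n)} → (∀ {p} → p ∈ ps → GoodPair n k p) →
                  ∀ {q} → q ∈ insertions ps → GoodPair (suc n) k q
insertions-good {n} {k} {ps} good q∈ =
  let (ab , p , _ , p∈ , q≡) = ∈-cartesianProductWith⁻ insertAfter² (allFin² n) ps q∈
  in subst (GoodPair (suc n) k) (sym q≡) (goodPair-insertAfter² ab p (good p∈))

isPerm-[] : IsPerm {0} []
isPerm-[] = mkIsPerm [] (λ {x} _ → ⊥-elim (¬Fin0 x)) (λ y → ⊥-elim (¬Fin0 y))

goodPairs-sound : ∀ n k {p} → p ∈ goodPairs n k → GoodPair n k p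
goodPairs-sound zero zero (here refl) = isPerm-[] , isPerm-[] , numberOf-Fin0 _ , numberOf-Fin0 _ , λ ()
goodPairs-sound zero zero (there ())
goodPairs-sound zero (suc k) ()
goodPairs-sound (suc n) zero p∈ = insertions-good (goodPairs-sound n 0) p∈
goodPairs-sound (suc n) (suc k) p∈ with ∈-++⁻ (map fixLast² (goodPairs n k)) p∈
... | inj₁ p∈fixed = let (q , q∈ , p≡) = ∈-map⁻ fixLast² p∈fixed in
                      subst (GoodPair (suc n) (suc k)) (sym p≡) (goodPair-fixLast² q (goodPairs-sound n k q∈))
... | inj₂ p∈inserted = insertions-good (goodPairs-sound n (suc k)) p∈inserted

insertions⊆goodPairs : ∀ n k {p} → p ∈ insertions (goodPairs n k) → p ∈ goodPairs (suc n) k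
insertions⊆goodPairs n zero p∈ = p∈
insertions⊆goodPairs n (suc k) p∈ = ∈-++⁺ʳ (map fixLast² (goodPairs n k)) p∈

goodPairs-complete : ∀ n k p → GoodPair n k p → p ∈ goodPairs n k
goodPairs-complete zero zero ([] , []) _ = here refl
goodPairs-complete zero (suc k) ([] , []) (_ , _ , cycles , _) = ⊥-elim (ℕP.0≢1+n (numberOf-unique (numberOf-Fin0 _) cycles))
goodPairs-complete (suc n) k (σ′ , τ′) (σ′-perm , τ′-perm , σ′-cycles , τ′-cycles , same)
  with extension σ′ σ′-perm | extension τ′ τ′-perm
... | fixed σ _ | inserted b τ _ =
  ⊥-elim (¬isCycMin-insertAfter-fromℕ τ b (to (same (fromℕ n)) (isCycMin-fixLast-fromℕ σ)))
... | inserted a σ _ | fixed τ _ =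
  ⊥-elim (¬isCycMin-insertAfter-fromℕ σ a (from (same (fromℕ n)) (isCycMin-fixLast-fromℕ τ)))
... | inserted a σ σ-perm | inserted b τ τ-perm =
  insertions⊆goodPairs n k (∈-insertions⁺ (a , b) (goodPairs-complete n k (σ , τ)
    (σ-perm , τ-perm , hasCycles-insertAfter⁻ σ a σ-perm σ′-cycles , hasCycles-insertAfter⁻ τ b τ-perm τ′-cycles ,
     sameMin⁻ (follows-insertAfter σ a) (follows-insertAfter τ b) same)))
... | fixed σ σ-perm | fixed τ τ-perm
  with hasCycles-fixLast⁻ σ σ-perm σ′-cycles | hasCycles-fixLast⁻ τ τ-perm τ′-cycles
...   | m , refl , σ-cycles | _ , k≡ , τ-cycles =
  ∈-++⁺ˡ (∈-map⁺ fixLast² (goodPairs-complete n m (σ , τ)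
    (σ-perm , τ-perm , σ-cycles , subst (HasCycles τ) (sym (ℕP.suc-injective k≡)) τ-cycles ,
     sameMin⁻ (follows-fixLast σ) (follows-fixLast τ) same)))

-- The count holds for all n and k.
corollary10 : (n k : ℕ) → 1 ≤ k → k ≤ n → NumberOf (GoodPair n k) ∣ u n k ∣
corollary10 n k _ _ =
  goodPairs n k ,
  goodPairs-unique n k ,
  (λ p → mk⇔ (goodPairs-sound n k) (goodPairs-complete n k p)) ,
  trans (length-goodPairs n k) (sym (∣u∣≡u⁺ n k))
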